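{- Let $\{\pi_1,\dots,\pi_n\}\subseteq S_n$ be a set of permutations such that either $\mathrm{Des}(\pi_i)=\{i-1,i\}\cap[n-1]$ for all $1\le i\le n$, or $\mathrm{Des}(\pi_i)=[n-1]\setminus\{i-1,i\}$ for all $1\le i\le n$. Then $\{\pi_1,\dots,\pi_n\}$ is symmetric.
   Context: For $w\in S_n$, $\mathrm{Des}(w)=\{i\in[n-1]: w(i)>w(i+1)\}$; $F_{n,D}=\sum x_{i_1}\cdots x_{i_n}$ over $i_1\le\dots\le i_n$ with $i_j<i_{j+1}$ for $j\in D$; $Q(S)=\sum_{w\in S}F_{n,\mathrm{Des}(w)}$; $S$ is symmetric if $Q(S)$ is a symmetric function. -}

module Defs where

open import Data.Nat using (ℕ; zero; suc; _∸_; _≤_; _<_; _<?_; _≤?_)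
open import Data.Fin using (Fin; toℕ; fromℕ<)
import Data.Fin as F
import Data.Fin.Properties as FP
open import Data.Fin.Permutation using (Permutation′; _⟨$⟩ʳ_; _≈_)
open import Data.List using (List; length; filter; allFin)
open import Data.Product using (_×_; Σ)
open import Relation.Nullary using (¬_; Dec; yes; no)
open import Relation.Nullary.Decidable using (_×-dec_; _→-dec_; ¬?)
open import Relation.Binary.PropositionalEquality using (_≡_)
open import Function.Bundles using (_↔_; Inverse)

ext : ∀ {n} → (Fin n → ℕ) → ℕ → ℕ
ext {n} f j with j <? n
... | yes p = f (fromℕ< p)
... | no _ = 0

-- one-line notation of w, positions 0-based: at w (k-1) = w(k) for 1 ≤ k ≤ n
at : ∀ {n} → Permutation′ n → ℕ → ℕ
at w = ext (λ k → toℕ (w ⟨$⟩ʳ k))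

-- j ∈ Des(w)  (j 1-based, j ∈ [n-1], w(j) > w(j+1))
IsDes : ∀ {n} → Permutation′ n → ℕ → Set
IsDes {n} w j = (1 ≤ j) × (j < n) × (at w j < at w (j ∸ 1))

isDes? : ∀ {n} (w : Permutation′ n) (j : ℕ) → Dec (IsDes w j)
isDes? {n} w j = (1 ≤? j) ×-dec (j <? n) ×-dec (at w j <? at w (j ∸ 1))

-- A degree-n monomial x_{v 0} ⋯ x_{v (n-1)} (variables indexed by ℕ),
-- written in its canonical weakly increasing form.
WeaklyIncreasing : ∀ {n} → (Fin n → ℕ) → Set
WeaklyIncreasing {n} v = ∀ (a b : Fin n) → toℕ a ≤ toℕ b → v a ≤ v b

-- The coefficient of F_{n,Des(w)} at the monomial v (weakly increasing) is 1
-- iff v is strictly increasing across every descent of w, else 0.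
Compatible : ∀ {n} → Permutation′ n → (Fin n → ℕ) → Set
Compatible {n} w v = ∀ (j : Fin n) → IsDes w (toℕ j) → ext v (toℕ j ∸ 1) < ext v (toℕ j)

compatible? : ∀ {n} (w : Permutation′ n) (v : Fin n → ℕ) → Dec (Compatible w v)
compatible? w v = FP.all? (λ j → isDes? w (toℕ j) →-dec (ext v (toℕ j ∸ 1) <? ext v (toℕ j)))

-- The finite set S = { f k : k ∈ Fin m } ⊆ S_n: index k is the first occurrence of its element.
FirstOcc : ∀ {m n} → (Fin m → Permutation′ n) → Fin m → Set
FirstOcc f k = ∀ k' → k' F.< k → ¬ (f k' ≈ f k)

firstOcc? : ∀ {m n} (f : Fin m → Permutation′ n) (k : Fin m) → Dec (FirstOcc f k)
firstOcc? f k = FP.all? (λ k' → (k' F.<? k) →-dec ¬? (FP.all? (λ i → (f k' ⟨$⟩ʳ i) F.≟ (f k ⟨$⟩ʳ i))))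

-- Coefficient of the monomial v in Q(S) = Σ_{w ∈ S} F_{n,Des(w)}, S = image of f.
coeffQ : ∀ {m n} → (Fin m → Permutation′ n) → (Fin n → ℕ) → ℕ
coeffQ f v = length (filter (λ k → compatible? (f k) v ×-dec firstOcc? f k) (allFin _))

-- Q(S) is homogeneous of degree n, so only degree-n monomials matter; σ maps
-- x_{v 0}⋯x_{v(n-1)} to x_{v' 0}⋯x_{v'(n-1)} iff σ ∘ v is a rearrangement τ of v'.
IsSymmetric : ∀ {m n} → (Fin m → Permutation′ n) → Set
IsSymmetric {m} {n} f =
  ∀ (v v' : Fin n → ℕ) → WeaklyIncreasing v → WeaklyIncreasing v' →
  (σ : ℕ ↔ ℕ) (τ : Permutation′ n) →
  (∀ j → v' j ≡ Inverse.to σ (v (τ ⟨$⟩ʳ j))) →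
  coeffQ f v ≡ coeffQ f v'

module Submission where

-- Write a degree-n monomial as a weakly increasing sequence v. It occurs in F_{n,D} iff D contains
-- no plateau of v, i.e. no gap e with v (e - 1) = v e. Each plateau makes the two positions around
-- it repeated (their value occurs elsewhere), and the number r of repeated positions is invariant
-- under permuting the variables. If Des(π_i) = {i-1, i}, then π_i is compatible with v iff position
-- i is not repeated, so the coefficient is the number of unrepeated positions. If Des(π_i) is the
-- complement, π_i is compatible iff every plateau lies in {i-1, i}; the number of such i is n, 2, 1
-- or 0 according as r = 0, 2, 3 or r ≥ 4. For n ≥ 3 the π_i have distinct descent sets, so the set
-- has n elements; for n ≤ 2 there is at most one gap, and whether it is a plateau is invariant.

open import Defs
open import Data.Fin using (Fin; toℕ; fromℕ<)
import Data.Fin as F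
import Data.Fin.Properties as FP
open import Data.Fin.Permutation using (Permutation′; _⟨$⟩ʳ_; _⟨$⟩ˡ_; _≈_; inverseʳ)
open import Data.List using (List; []; _∷_; _∷ʳ_; length; filter; tabulate)
open import Data.List.Membership.Propositional using (_∈_)
import Data.List.Relation.Unary.All as All
import Data.List.Relation.Unary.All.Properties as All
open import Data.List.Relation.Unary.AllPairs using (AllPairs; _∷_)
open import Data.List.Relation.Unary.Any using (here; there)
open import Data.List.Relation.Unary.Any.Properties using (∷↔)
open import Data.List.Relation.Unary.Linked using (Linked; [-]; _∷_)
open import Data.List.Relation.Unary.Linked.Properties using (Linked⇒AllPairs)
open import Data.Nat using (ℕ; zero; suc; _≤_; _<_; _∸_; z≤n; s≤s; z<s; _+_; _<?_; _≤?_)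
open import Data.Nat.Properties
open import Algebra.Properties.CommutativeMonoid.Sum +-0-commutativeMonoid using (sum; ∑-permute)
open import Data.List.Membership.DecPropositional _≟_ using (_∈?_)
open import Data.Product using (∃; _×_; _,_; proj₁; proj₂)
open import Data.Product.Function.NonDependent.Propositional using (_×-⇔_)
open import Data.Sum using (_⊎_; inj₁; inj₂; [_,_]′)
open import Function using (id; _∘_; _⇔_; mk⇔; Injective; Injection)
open import Function.Bundles using (module Equivalence)
import Function.Properties.Equivalence as ⇔
open import Function.Properties.Inverse using (↔⇒⇔; ↔⇒↣)
open import Function.Related.TypeIsomorphisms using (¬-cong-⇔)
open import Relation.Binary.Definitions using (tri<; tri≈; tri>)
open import Relation.Binary.PropositionalEquality
open import Relation.Nullary using (¬_; Dec; yes; no; contradiction)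
open import Relation.Nullary.Decidable using (_⊎-dec_; _×-dec_; ¬?)
open import Relation.Unary using (Pred; Decidable)

open Equivalence using (to; from)

-- Counting over Fin n

indicator : ∀ {p} {P : Set p} → Dec P → ℕ
indicator (yes _) = 1
indicator (no _)  = 0

count : ∀ {n p} {P : Pred (Fin n) p} → Decidable P → ℕ
count {zero}  P? = 0
count {suc n} P? = indicator (P? F.zero) + count (P? ∘ F.suc)

count-mono : ∀ {n p q} {P : Pred (Fin n) p} {Q : Pred (Fin n) q} (P? : Decidable P) (Q? : Decidable Q) →
             (∀ i → P i → Q i) → count P? ≤ count Q?
count-mono {zero}  P? Q? P⇒Q = z≤n
count-mono {suc n} P? Q? P⇒Q with P? F.zero | Q? F.zero | count-mono (P? ∘ F.suc) (Q? ∘ F.suc) (P⇒Q ∘ F.suc)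
... | yes _ | yes _ | rest = s≤s rest
... | no _  | yes _ | rest = m≤n⇒m≤1+n rest
... | no _  | no _  | rest = rest
... | yes p | no ¬q | _    = contradiction (P⇒Q F.zero p) ¬q

count-cong : ∀ {n p q} {P : Pred (Fin n) p} {Q : Pred (Fin n) q} (P? : Decidable P) (Q? : Decidable Q) →
             (∀ i → P i ⇔ Q i) → count P? ≡ count Q?
count-cong P? Q? P⇔Q = ≤-antisym (count-mono P? Q? (to ∘ P⇔Q)) (count-mono Q? P? (from ∘ P⇔Q))

count-⊎ : ∀ {n p q} {P : Pred (Fin n) p} {Q : Pred (Fin n) q} (P? : Decidable P) (Q? : Decidable Q) →
          (∀ i → P i → ¬ Q i) → count (λ i → P? i ⊎-dec Q? i) ≡ count P? + count Q?
count-⊎ {zero}  P? Q? disjoint = refl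
count-⊎ {suc n} P? Q? disjoint with P? F.zero | Q? F.zero | count-⊎ (P? ∘ F.suc) (Q? ∘ F.suc) (disjoint ∘ F.suc)
... | yes _ | no _  | rest = cong suc rest
... | no _  | yes _ | rest = trans (cong suc rest) (sym (+-suc _ _))
... | no _  | no _  | rest = rest
... | yes p | yes q | _    = contradiction q (disjoint F.zero p)

count-all : ∀ {n p} {P : Pred (Fin n) p} (P? : Decidable P) → (∀ i → P i) → count P? ≡ n
count-all {zero}  P? all = refl
count-all {suc n} P? all with P? F.zero
... | yes _ = cong suc (count-all (P? ∘ F.suc) (all ∘ F.suc))
... | no ¬p = contradiction (all F.zero) ¬p

count-none : ∀ {n p} {P : Pred (Fin n) p} (P? : Decidable P) → (∀ i → ¬ P i) → count P? ≡ 0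
count-none {zero}  P? none = refl
count-none {suc n} P? none with P? F.zero
... | yes p = contradiction p (none F.zero)
... | no _  = count-none (P? ∘ F.suc) (none ∘ F.suc)

count≡sum : ∀ {n p} {P : Pred (Fin n) p} (P? : Decidable P) → count P? ≡ sum (indicator ∘ P?)
count≡sum {zero}  P? = refl
count≡sum {suc n} P? = cong (indicator (P? F.zero) +_) (count≡sum (P? ∘ F.suc))

count-permute : ∀ {n p} {P : Pred (Fin n) p} (P? : Decidable P) (τ : Permutation′ n) →
                count (P? ∘ (τ ⟨$⟩ʳ_)) ≡ count P?
count-permute P? τ = begin
  count (P? ∘ (τ ⟨$⟩ʳ_))              ≡⟨ count≡sum (P? ∘ (τ ⟨$⟩ʳ_)) ⟩
  sum (indicator ∘ P? ∘ (τ ⟨$⟩ʳ_))    ≡⟨ ∑-permute (indicator ∘ P?) τ ⟨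
  sum (indicator ∘ P?)                ≡⟨ count≡sum P? ⟨
  count P?                            ∎
  where open ≡-Reasoning

length-filter-tabulate : ∀ {a p n} {A : Set a} {P : Pred A p} (P? : Decidable P) (g : Fin n → A) →
                         length (filter P? (tabulate g)) ≡ count (P? ∘ g)
length-filter-tabulate {n = zero}  P? g = refl
length-filter-tabulate {n = suc n} P? g with P? (g F.zero)
... | yes _ = cong suc (length-filter-tabulate P? (g ∘ F.suc))
... | no _  = length-filter-tabulate P? (g ∘ F.suc)

count-toℕ≡ : ∀ {n} x → x < n → count (λ (i : Fin n) → toℕ i ≟ x) ≡ 1
count-toℕ≡ {suc n} zero    _         = cong suc (count-none {n} (λ i → toℕ (F.suc i) ≟ 0) (λ _ ()))
count-toℕ≡ {suc n} (suc x) (s≤s x<n) = trans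
  (count-cong {n} (λ i → toℕ (F.suc i) ≟ suc x) (λ i → toℕ i ≟ x) (λ _ → mk⇔ suc-injective (cong suc)))
  (count-toℕ≡ x x<n)

-- The hypothesis says that xs is strictly increasing and bounded by n.
count-toℕ∈ : ∀ {n} xs → Linked _<_ (xs ∷ʳ n) → count (λ (i : Fin n) → toℕ i ∈? xs) ≡ length xs
count-toℕ∈ {n} xs = go xs ∘ Linked⇒AllPairs <-trans
  where
  go : ∀ xs → AllPairs _<_ (xs ∷ʳ n) → count (λ (i : Fin n) → toℕ i ∈? xs) ≡ length xs
  go []       _                 = count-none {n} (λ i → toℕ i ∈? []) (λ _ ())
  go (x ∷ xs) (x<rest ∷ sorted) = begin
    count (λ (i : Fin n) → toℕ i ∈? (x ∷ xs))
      ≡⟨ count-cong {n} _ _ (λ i → ⇔.sym (↔⇒⇔ (∷↔ (toℕ i ≡_)))) ⟩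
    count (λ (i : Fin n) → (toℕ i ≟ x) ⊎-dec (toℕ i ∈? xs))
      ≡⟨ count-⊎ (λ i → toℕ i ≟ x) (λ i → toℕ i ∈? xs) x∉xs ⟩
    count (λ (i : Fin n) → toℕ i ≟ x) + count (λ (i : Fin n) → toℕ i ∈? xs)
      ≡⟨ cong₂ _+_ (count-toℕ≡ x x<n) (go xs sorted) ⟩
    suc (length xs)
      ∎
    where
    open ≡-Reasoning
    x<n : x < n
    x<n = All.head (All.++⁻ʳ xs x<rest)
    x∉xs : ∀ (i : Fin n) → toℕ i ≡ x → ¬ toℕ i ∈ xs
    x∉xs i i≡x i∈xs = <-irrefl refl (All.lookup (All.++⁻ˡ xs x<rest) (subst (_∈ xs) i≡x i∈xs))

-- Gaps, windows and plateaus

Gap : ℕ → ℕ → Set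
Gap n e = 1 ≤ e × e < n

-- Gaps are numbered as in IsDes: gap e lies between positions e - 1 and e (0-based), so the gaps
-- next to position t are t and t + 1.
Flanking : ℕ → ℕ → Set
Flanking t e = e ≡ t ⊎ e ≡ suc t

flanking? : ∀ t e → Dec (Flanking t e)
flanking? t e = (e ≟ t) ⊎-dec (e ≟ suc t)

flanking-between : ∀ {a b} → a ≤ b → b ≤ suc a → Flanking a b
flanking-between a≤b b≤1+a with m≤n⇒m<n∨m≡n b≤1+a
... | inj₁ b<1+a = inj₁ (≤-antisym (m<1+n⇒m≤n b<1+a) a≤b)
... | inj₂ b≡1+a = inj₂ b≡1+a

flanking-both : ∀ {t y} → Flanking t (suc y) → Flanking t (suc (suc y)) → t ≡ suc y
flanking-both (inj₁ refl) _ = refl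
flanking-both (inj₂ refl) (inj₁ ())
flanking-both (inj₂ refl) (inj₂ ())

flanking⇔∈ : ∀ {t y} → Flanking t (suc y) ⇔ t ∈ y ∷ suc y ∷ []
flanking⇔∈ = mk⇔ (λ { (inj₁ refl) → there (here refl) ; (inj₂ refl) → here refl })
                 (λ { (here refl) → inj₂ refl ; (there (here refl)) → inj₁ refl })

flanking-pair⇔∈ : ∀ {t y} → (Flanking t (suc y) ⊎ Flanking t (suc (suc y))) ⇔ t ∈ y ∷ suc y ∷ suc (suc y) ∷ []
flanking-pair⇔∈ = mk⇔
  (λ { (inj₁ (inj₁ refl)) → there (here refl) ; (inj₁ (inj₂ refl)) → here refl
     ; (inj₂ (inj₁ refl)) → there (there (here refl)) ; (inj₂ (inj₂ refl)) → there (here refl) })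
  (λ { (here refl) → inj₁ (inj₂ refl) ; (there (here refl)) → inj₁ (inj₁ refl)
     ; (there (there (here refl))) → inj₂ (inj₁ refl) })

gap-unique : ∀ {n x y} → n ≤ 2 → Gap n x → Gap n y → x ≡ y
gap-unique {n} n≤2 gap-x gap-y = trans (≡1 gap-x) (sym (≡1 gap-y))
  where
  ≡1 : ∀ {z} → Gap n z → z ≡ 1
  ≡1 (1≤z , z<n) = ≤-antisym (≤-pred (≤-trans z<n n≤2)) 1≤z

Window CoWindow : ℕ → ℕ → ℕ → Set
Window   n t j = Flanking t j × Gap n j
CoWindow n t j = Gap n j × ¬ Flanking t j

-- The gap a (if a ≥ 1), respectively 2 (if a = 0), lies in exactly one of the two windows.
neighbouring-windows-differ : ∀ {n} a → 3 ≤ n → suc a < n → ¬ (∀ j → Window n a j ⇔ Window n (suc a) j)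
neighbouring-windows-differ zero 3≤n _ same with proj₁ (from (same 2) (inj₂ refl , s≤s z≤n , 3≤n))
... | inj₁ ()
... | inj₂ ()
neighbouring-windows-differ (suc a) _ 2+a<n same
  with proj₁ (to (same (suc a)) (inj₁ refl , s≤s z≤n , <-trans (n<1+n _) 2+a<n))
... | inj₁ ()
... | inj₂ ()

-- The gap a + 1 lies in the window of a, which forces b = a + 1.
windows-differ : ∀ {n a b} → 3 ≤ n → a < b → b < n → ¬ (∀ j → Window n a j ⇔ Window n b j)
windows-differ {a = a} 3≤n a<b b<n same with proj₁ (to (same (suc a)) (inj₂ refl , s≤s z≤n , ≤-<-trans a<b b<n))
... | inj₁ refl     = neighbouring-windows-differ a 3≤n b<n same
... | inj₂ 1+a≡1+b = <⇒≢ a<b (suc-injective 1+a≡1+b)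

window-injective : ∀ {n a b} → 3 ≤ n → a < n → b < n → (∀ j → Window n a j ⇔ Window n b j) → a ≡ b
window-injective 3≤n a<n b<n same with <-cmp _ _
... | tri< a<b _ _ = contradiction same (windows-differ 3≤n a<b b<n)
... | tri≈ _ a≡b _ = a≡b
... | tri> _ _ b<a = contradiction (⇔.sym ∘ same) (windows-differ 3≤n b<a a<n)

cowindow-injective : ∀ {n a b} → 3 ≤ n → a < n → b < n → (∀ j → CoWindow n a j ⇔ CoWindow n b j) → a ≡ b
cowindow-injective {n} 3≤n a<n b<n same =
  window-injective 3≤n a<n b<n (λ j → mk⇔ (window⇒window same j) (window⇒window (⇔.sym ∘ same) j))
  where
  window⇒window : ∀ {s t} → (∀ j → CoWindow n s j ⇔ CoWindow n t j) → ∀ j → Window n s j → Window n t j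
  window⇒window {s} {t} same j (flank , gap) with flanking? t j
  ... | yes flank′ = flank′ , gap
  ... | no ¬flank′ = contradiction flank (proj₂ (from (same j) (gap , ¬flank′)))

module _ {n} (v : Fin n → ℕ) where

  ext-fromℕ< : ∀ {m} (m<n : m < n) → ext v m ≡ v (fromℕ< m<n)
  ext-fromℕ< {m} m<n with m <? n
  ... | yes _  = cong v (FP.fromℕ<-cong _ _ refl _ _)
  ... | no m≮n = contradiction m<n m≮n

  ext-toℕ : ∀ k → ext v (toℕ k) ≡ v k
  ext-toℕ k = trans (ext-fromℕ< (FP.toℕ<n k)) (cong v (FP.fromℕ<-toℕ k _))

  Plateau : ℕ → Set
  Plateau e = Gap n e × ext v (e ∸ 1) ≡ ext v e

  plateau? : Decidable Plateau
  plateau? e = ((1 ≤? e) ×-dec (e <? n)) ×-dec (ext v (e ∸ 1) ≟ ext v e)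

  Repeated : Fin n → Set
  Repeated j = ∃ λ k → k ≢ j × v k ≡ v j

  repeated? : Decidable Repeated
  repeated? j = FP.any? (λ k → ¬? (k F.≟ j) ×-dec (v k ≟ v j))

AllPlateausFlank : ∀ {n} → (Fin n → ℕ) → ℕ → Set
AllPlateausFlank v t = ∀ e → Plateau v e → Flanking t e

ext-cong : ∀ {n} {f g : Fin n → ℕ} → (∀ k → f k ≡ g k) → ∀ j → ext f j ≡ ext g j
ext-cong {n} f≗g j with j <? n
... | yes _ = f≗g _
... | no _  = refl

module _ {n} {v : Fin n → ℕ} (v↑ : WeaklyIncreasing v) where

  ext-mono : ∀ {a b} → a ≤ b → b < n → ext v a ≤ ext v b
  ext-mono {a} {b} a≤b b<n = begin
    ext v a         ≡⟨ ext-fromℕ< v a<n ⟩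
    v (fromℕ< a<n)  ≤⟨ v↑ _ _ (subst₂ _≤_ (sym (FP.toℕ-fromℕ< a<n)) (sym (FP.toℕ-fromℕ< b<n)) a≤b) ⟩
    v (fromℕ< b<n)  ≡⟨ ext-fromℕ< v b<n ⟨
    ext v b         ∎
    where
    open ≤-Reasoning
    a<n : a < n
    a<n = ≤-<-trans a≤b b<n

  ext-squeeze : ∀ {a b c} → a ≤ b → b ≤ c → c < n → ext v a ≡ ext v c → ext v a ≡ ext v b × ext v b ≡ ext v c
  ext-squeeze {a} {b} {c} a≤b b≤c c<n va≡vc = trans va≡vc (sym vb≡vc) , vb≡vc
    where
    vb≡vc : ext v b ≡ ext v c
    vb≡vc = ≤-antisym (ext-mono b≤c c<n) (subst (_≤ ext v b) va≡vc (ext-mono a≤b (≤-<-trans b≤c c<n)))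

  compatible⇔ : ∀ w → Compatible w v ⇔ (∀ e → Plateau v e → ¬ IsDes w e)
  compatible⇔ w = mk⇔ avoids compatible
    where
    avoids : Compatible w v → ∀ e → Plateau v e → ¬ IsDes w e
    avoids c e ((_ , e<n) , flat) des = <-irrefl flat (subst (λ t → ext v (t ∸ 1) < ext v t) (FP.toℕ-fromℕ< e<n)
      (c (fromℕ< e<n) (subst (IsDes w) (sym (FP.toℕ-fromℕ< e<n)) des)))
    compatible : (∀ e → Plateau v e → ¬ IsDes w e) → Compatible w v
    compatible avoid j des@(1≤t , t<n , _) =
      ≤∧≢⇒< (ext-mono (m∸n≤m _ 1) t<n) (λ flat → avoid (toℕ j) ((1≤t , t<n) , flat) des)

  repeated⇔plateau : ∀ j → Repeated v j ⇔ (∃ λ e → Flanking (toℕ j) e × Plateau v e)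
  repeated⇔plateau j = mk⇔ plateau repeated
    where
    t : ℕ
    t = toℕ j
    same-value : ∀ {k} → v k ≡ v j → ext v (toℕ k) ≡ ext v t
    same-value {k} vk≡vj = trans (ext-toℕ v k) (trans vk≡vj (sym (ext-toℕ v j)))
    plateau : Repeated v j → ∃ λ e → Flanking t e × Plateau v e
    plateau (k , k≢j , vk≡vj) with <-cmp (toℕ k) t
    ... | tri< k<t _ _ = t , inj₁ refl , (≤-trans (s≤s z≤n) k<t , FP.toℕ<n j) ,
            proj₂ (ext-squeeze (∸-monoˡ-≤ 1 k<t) (m∸n≤m t 1) (FP.toℕ<n j) (same-value vk≡vj))
    ... | tri≈ _ k≡t _ = contradiction (FP.toℕ-injective k≡t) k≢j
    ... | tri> _ _ t<k = suc t , inj₂ refl , (s≤s z≤n , ≤-<-trans t<k (FP.toℕ<n k)) ,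
            proj₁ (ext-squeeze (n≤1+n t) t<k (FP.toℕ<n k) (sym (same-value vk≡vj)))
    repeated : (∃ λ e → Flanking t e × Plateau v e) → Repeated v j
    repeated (_ , inj₁ refl , ((1≤t , t<n) , flat)) =
      fromℕ< t-1<n ,
      (λ k≡j → <⇒≢ t-1<t (trans (sym (FP.toℕ-fromℕ< t-1<n)) (cong toℕ k≡j))) ,
      trans (sym (ext-fromℕ< v t-1<n)) (trans flat (ext-toℕ v j))
      where
      t-1<t : t ∸ 1 < t
      t-1<t = ∸-monoʳ-< {o = 0} z<s 1≤t
      t-1<n : t ∸ 1 < n
      t-1<n = <-trans t-1<t t<n
    repeated (_ , inj₂ refl , ((_ , t+1<n) , flat)) =
      fromℕ< t+1<n ,
      (λ k≡j → <⇒≢ (n<1+n t) (trans (cong toℕ (sym k≡j)) (FP.toℕ-fromℕ< t+1<n))) ,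
      trans (sym (ext-fromℕ< v t+1<n)) (trans (sym flat) (ext-toℕ v j))

  plateau⇒repeated : ∀ {e} → Plateau v e → ∃ (Repeated v)
  plateau⇒repeated {e} pl@((_ , e<n) , _) =
    fromℕ< e<n , from (repeated⇔plateau (fromℕ< e<n)) (e , inj₁ (sym (FP.toℕ-fromℕ< e<n)) , pl)

  plateau⇔repeated-≤2 : n ≤ 2 → ∀ e → Plateau v e ⇔ (Gap n e × ∃ (Repeated v))
  plateau⇔repeated-≤2 n≤2 e = mk⇔ (λ pl → proj₁ pl , plateau⇒repeated pl)
    (λ (gap , j , rep) → let (x , _ , px) = to (repeated⇔plateau j) rep in
                         subst (Plateau v) (gap-unique n≤2 (proj₁ px) gap) px)

compatible-cong : ∀ {n} {v v' : Fin n → ℕ} → WeaklyIncreasing v → WeaklyIncreasing v' →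
                  (∀ e → Plateau v e ⇔ Plateau v' e) → ∀ w → Compatible w v ⇔ Compatible w v'
compatible-cong v↑ v'↑ same w = ⇔.trans (compatible⇔ v↑ w) (⇔.trans
  (mk⇔ (λ avoid e pl′ → avoid e (from (same e) pl′)) (λ avoid e pl → avoid e (to (same e) pl)))
  (⇔.sym (compatible⇔ v'↑ w)))

-- Relabelling the variables

module _ {n} {v v' : Fin n → ℕ} {g : ℕ → ℕ} (g-injective : Injective _≡_ _≡_ g) (τ : Permutation′ n)
         (v'≡g∘v∘τ : ∀ j → v' j ≡ g (v (τ ⟨$⟩ʳ j))) where

  repeated-relabel : ∀ j → Repeated v' j ⇔ Repeated v (τ ⟨$⟩ʳ j)
  repeated-relabel j = mk⇔
    (λ (k , k≢j , v'k≡v'j) → τ ⟨$⟩ʳ k , k≢j ∘ Injection.injective (↔⇒↣ τ) ,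
       g-injective (trans (sym (v'≡g∘v∘τ k)) (trans v'k≡v'j (v'≡g∘v∘τ j))))
    (λ (k , k≢τj , vk≡vτj) → τ ⟨$⟩ˡ k ,
       (λ τ⁻¹k≡j → k≢τj (trans (sym (inverseʳ τ)) (cong (τ ⟨$⟩ʳ_) τ⁻¹k≡j))) ,
       trans (v'≡g∘v∘τ _) (trans (cong (g ∘ v) (inverseʳ τ)) (trans (cong g vk≡vτj) (sym (v'≡g∘v∘τ j)))))

  ∃repeated-relabel : ∃ (Repeated v') ⇔ ∃ (Repeated v)
  ∃repeated-relabel = mk⇔
    (λ (j , rep) → τ ⟨$⟩ʳ j , to (repeated-relabel j) rep)
    (λ (k , rep) → τ ⟨$⟩ˡ k , from (repeated-relabel (τ ⟨$⟩ˡ k)) (subst (Repeated v) (sym (inverseʳ τ)) rep))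

  count-repeated-relabel : count (repeated? v') ≡ count (repeated? v)
  count-repeated-relabel = trans
    (count-cong (repeated? v') (repeated? v ∘ (τ ⟨$⟩ʳ_)) repeated-relabel)
    (count-permute (repeated? v) τ)

  count-unrepeated-relabel : count (¬? ∘ repeated? v') ≡ count (¬? ∘ repeated? v)
  count-unrepeated-relabel = trans
    (count-cong (¬? ∘ repeated? v') (¬? ∘ repeated? v ∘ (τ ⟨$⟩ʳ_)) (¬-cong-⇔ ∘ repeated-relabel))
    (count-permute (¬? ∘ repeated? v) τ)

-- Descent sets and coefficients

same-descents : ∀ {n} {w w' : Permutation′ n} → w ≈ w' → ∀ j → IsDes w j ⇔ IsDes w' j
same-descents {n} {w} {w'} w≈w' j = mk⇔ (transport {w} {w'} w≈w') (transport {w'} {w} (λ i → sym (w≈w' i)))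
  where
  transport : ∀ {u u' : Permutation′ n} → u ≈ u' → IsDes u j → IsDes u' j
  transport {u} {u'} u≈u' (1≤j , j<n , lt) = 1≤j , j<n , subst₂ _<_ (at≡ j) (at≡ (j ∸ 1)) lt
    where
    at≡ : ∀ i → at u i ≡ at u' i
    at≡ = ext-cong (cong toℕ ∘ u≈u')

descents-injective : ∀ {m n} {D : Fin m → ℕ → Set} (π : Fin m → Permutation′ n) →
  (∀ i j → IsDes (π i) j ⇔ D i j) → (∀ a b → (∀ j → D a j ⇔ D b j) → a ≡ b) → ∀ a b → π a ≈ π b → a ≡ b
descents-injective π des D-injective a b πa≈πb =
  D-injective a b (λ j → ⇔.trans (⇔.sym (des a j)) (⇔.trans (same-descents {w = π a} {π b} πa≈πb j) (des b j)))

module _ {m n} (f : Fin m → Permutation′ n) where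

  coeffQ≡count : ∀ v → coeffQ f v ≡ count (λ k → compatible? (f k) v ×-dec firstOcc? f k)
  coeffQ≡count v = length-filter-tabulate (λ k → compatible? (f k) v ×-dec firstOcc? f k) id

  coeffQ-cong : ∀ {v v'} → (∀ k → Compatible (f k) v ⇔ Compatible (f k) v') → coeffQ f v ≡ coeffQ f v'
  coeffQ-cong {v} {v'} compatible⇔ = begin
    coeffQ f v                                              ≡⟨ coeffQ≡count v ⟩
    count (λ k → compatible? (f k) v ×-dec firstOcc? f k)   ≡⟨ count-cong _ _ (λ k → compatible⇔ k ×-⇔ ⇔.refl) ⟩
    count (λ k → compatible? (f k) v' ×-dec firstOcc? f k)  ≡⟨ coeffQ≡count v' ⟨
    coeffQ f v'                                             ∎
    where open ≡-Reasoning

  coeffQ-injective : (∀ a b → f a ≈ f b → a ≡ b) → ∀ v → coeffQ f v ≡ count (λ k → compatible? (f k) v)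
  coeffQ-injective f-injective v = trans (coeffQ≡count v) (count-cong _ _ (λ k → mk⇔ proj₁ (_, first k)))
    where
    first : ∀ k → FirstOcc f k
    first k k' k'<k fk'≈fk = <⇒≢ k'<k (cong toℕ (f-injective k' k fk'≈fk))

symmetric-≤2 : ∀ {m n} (f : Fin m → Permutation′ n) → n ≤ 2 → IsSymmetric f
symmetric-≤2 f n≤2 v v' v↑ v'↑ σ τ v'≡σvτ = coeffQ-cong f (compatible-cong v↑ v'↑ same-plateaus ∘ f)
  where
  same-plateaus : ∀ e → Plateau v e ⇔ Plateau v' e
  same-plateaus e = ⇔.trans (plateau⇔repeated-≤2 v↑ n≤2 e) (⇔.trans
    (⇔.refl ×-⇔ ⇔.sym (∃repeated-relabel (Injection.injective (↔⇒↣ σ)) τ v'≡σvτ))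
    (⇔.sym (plateau⇔repeated-≤2 v'↑ n≤2 e)))

-- The two families

module _ {n} {v : Fin n → ℕ} (v↑ : WeaklyIncreasing v) (w : Permutation′ n) (i : Fin n) where

  compatible-window⇔unrepeated : (∀ j → IsDes w j ⇔ Window n (toℕ i) j) → Compatible w v ⇔ (¬ Repeated v i)
  compatible-window⇔unrepeated des = mk⇔
    (λ c rep → let (e , flank , pl) = to (repeated⇔plateau v↑ i) rep in
               to (compatible⇔ v↑ w) c e pl (from (des e) (flank , proj₁ pl)))
    (λ ¬rep → from (compatible⇔ v↑ w) λ e pl d →
                ¬rep (from (repeated⇔plateau v↑ i) (e , proj₁ (to (des e) d) , pl)))

  compatible-cowindow⇔flanked : (∀ j → IsDes w j ⇔ CoWindow n (toℕ i) j) →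
                                Compatible w v ⇔ AllPlateausFlank v (toℕ i)
  compatible-cowindow⇔flanked des = mk⇔ flanked
    (λ flanks → from (compatible⇔ v↑ w) (λ e pl d → proj₂ (to (des e) d) (flanks e pl)))
    where
    flanked : Compatible w v → AllPlateausFlank v (toℕ i)
    flanked c e pl with flanking? (toℕ i) e
    ... | yes flank = flank
    ... | no ¬flank = contradiction (from (des e) (proj₁ pl , ¬flank)) (to (compatible⇔ v↑ w) c e pl)

-- r = 0: there is no plateau. r = 2: one plateau e, flanking e - 1 and e. r = 3: two plateaus e and
-- e + 1, both flanking only e. r = 1 is impossible, and r ≥ 4 forces two plateaus at distance ≥ 2.
flankedPositions : ℕ → ℕ → ℕ
flankedPositions n 0 = n
flankedPositions n 2 = 2
flankedPositions n 3 = 1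
flankedPositions n _ = 0

flankedPositions-≥4 : ∀ {n r} → 4 ≤ r → flankedPositions n r ≡ 0
flankedPositions-≥4 (s≤s (s≤s (s≤s (s≤s _)))) = refl

module _ {n} {v : Fin n → ℕ} (v↑ : WeaklyIncreasing v)
         {C : Fin n → Set} (C? : Decidable C) (C⇔ : ∀ i → C i ⇔ AllPlateausFlank v (toℕ i)) where

  private
    r : ℕ
    r = count (repeated? v)

    settle : ∀ {k} → r ≡ k × count C? ≡ flankedPositions n k → count C? ≡ flankedPositions n r
    settle (r≡k , count≡) = trans count≡ (cong (flankedPositions n) (sym r≡k))

    flanked-at : ∀ {t} → t < n → AllPlateausFlank v t → ∃ λ i → AllPlateausFlank v (toℕ i)
    flanked-at t<n flanks = fromℕ< t<n , subst (AllPlateausFlank v) (sym (FP.toℕ-fromℕ< t<n)) flanks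

  no-plateau : (∀ e → ¬ Plateau v e) → r ≡ 0 × count C? ≡ n
  no-plateau none =
    count-none (repeated? v) (λ j rep → let (e , _ , pl) = to (repeated⇔plateau v↑ j) rep in none e pl) ,
    count-all C? (λ i → from (C⇔ i) (λ e pl → contradiction pl (none e)))

  one-plateau : ∀ {y} → Plateau v (suc y) → (∀ e → Plateau v e → e ≡ suc y) → r ≡ 2 × count C? ≡ 2
  one-plateau {y} pl only =
    trans (count-cong (repeated? v) (λ j → toℕ j ∈? pair) repeated⇔∈) (count-toℕ∈ pair sorted) ,
    trans (count-cong C? (λ i → toℕ i ∈? pair) C⇔∈) (count-toℕ∈ pair sorted)
    where
    pair : List ℕ
    pair = y ∷ suc y ∷ []
    sorted : Linked _<_ (pair ∷ʳ n)
    sorted = n<1+n y ∷ proj₂ (proj₁ pl) ∷ [-]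
    repeated⇔∈ : ∀ j → Repeated v j ⇔ toℕ j ∈ pair
    repeated⇔∈ j = ⇔.trans (repeated⇔plateau v↑ j)
      (mk⇔ (λ (e , flank , pl′) → to flanking⇔∈ (subst (Flanking (toℕ j)) (only e pl′) flank))
           (λ j∈pair → suc y , from flanking⇔∈ j∈pair , pl))
    C⇔∈ : ∀ i → C i ⇔ toℕ i ∈ pair
    C⇔∈ i = ⇔.trans (C⇔ i)
      (mk⇔ (λ flanks → to flanking⇔∈ (flanks _ pl))
           (λ i∈pair e pl′ → subst (Flanking (toℕ i)) (sym (only e pl′)) (from flanking⇔∈ i∈pair)))

  two-plateaus : ∀ {y} → Plateau v (suc y) → Plateau v (suc (suc y)) → AllPlateausFlank v (suc y) →
                 r ≡ 3 × count C? ≡ 1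
  two-plateaus {y} pl₁ pl₂ only =
    trans (count-cong (repeated? v) (λ j → toℕ j ∈? triple) repeated⇔∈) (count-toℕ∈ triple sorted) ,
    trans (count-cong C? (λ i → toℕ i ≟ suc y) C⇔≡) (count-toℕ≡ (suc y) (<-trans (n<1+n _) (proj₂ (proj₁ pl₂))))
    where
    triple : List ℕ
    triple = y ∷ suc y ∷ suc (suc y) ∷ []
    sorted : Linked _<_ (triple ∷ʳ n)
    sorted = n<1+n y ∷ n<1+n (suc y) ∷ proj₂ (proj₁ pl₂) ∷ [-]
    repeated⇔∈ : ∀ j → Repeated v j ⇔ toℕ j ∈ triple
    repeated⇔∈ j = ⇔.trans (repeated⇔plateau v↑ j) (⇔.trans
      (mk⇔ (λ (e , flank , pl) → [ (λ e≡1+y → inj₁ (subst (Flanking (toℕ j)) e≡1+y flank))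
                                 , (λ e≡2+y → inj₂ (subst (Flanking (toℕ j)) e≡2+y flank)) ]′ (only e pl))
           [ (λ flank → suc y , flank , pl₁) , (λ flank → suc (suc y) , flank , pl₂) ]′)
      flanking-pair⇔∈)
    C⇔≡ : ∀ i → C i ⇔ toℕ i ≡ suc y
    C⇔≡ i = ⇔.trans (C⇔ i)
      (mk⇔ (λ flanks → flanking-both (flanks _ pl₁) (flanks _ pl₂))
           (λ i≡1+y → subst (AllPlateausFlank v) (sym i≡1+y) only))

  plateaus-apart : ∀ {x y} → Plateau v x → Plateau v y → suc x < y → 4 ≤ r
  plateaus-apart {suc a} {suc b} pa@((s≤s z≤n , _) , _) pb@((_ , 1+b<n) , _) (s≤s 1+a<b) =
    subst (_≤ r) (count-toℕ∈ quadruple sorted) (count-mono (λ j → toℕ j ∈? quadruple) (repeated? v) ∈⇒repeated)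
    where
    quadruple : List ℕ
    quadruple = a ∷ suc a ∷ b ∷ suc b ∷ []
    sorted : Linked _<_ (quadruple ∷ʳ n)
    sorted = n<1+n a ∷ 1+a<b ∷ n<1+n b ∷ 1+b<n ∷ [-]
    flanked : ∀ {t} → t ∈ quadruple → ∃ λ e → Flanking t e × Plateau v e
    flanked (here refl)                         = suc a , inj₂ refl , pa
    flanked (there (here refl))                 = suc a , inj₁ refl , pa
    flanked (there (there (here refl)))         = suc b , inj₂ refl , pb
    flanked (there (there (there (here refl)))) = suc b , inj₁ refl , pb
    ∈⇒repeated : ∀ j → toℕ j ∈ quadruple → Repeated v j
    ∈⇒repeated j = from (repeated⇔plateau v↑ j) ∘ flanked

  plateaus-close : r < 4 → ∀ {x y} → Plateau v x → Plateau v y → y ≤ suc x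
  plateaus-close r<4 px py = ≮⇒≥ (λ 1+x<y → <⇒≱ r<4 (plateaus-apart px py 1+x<y))

  flanked⇒count : ∀ {t} → AllPlateausFlank v t → count C? ≡ flankedPositions n r
  flanked⇒count {t} flanks with plateau? v t | plateau? v (suc t)
  ... | no ¬pt | no ¬p1+t = settle (no-plateau λ e pl →
          [ (λ e≡t → ¬pt (subst (Plateau v) e≡t pl)) , (λ e≡1+t → ¬p1+t (subst (Plateau v) e≡1+t pl)) ]′ (flanks e pl))
  ... | yes pt@((s≤s z≤n , _) , _) | no ¬p1+t = settle (one-plateau pt λ e pl →
          [ id , (λ e≡1+t → contradiction (subst (Plateau v) e≡1+t pl) ¬p1+t) ]′ (flanks e pl))
  ... | no ¬pt | yes p1+t = settle (one-plateau p1+t λ e pl →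
          [ (λ e≡t → contradiction (subst (Plateau v) e≡t pl) ¬pt) , id ]′ (flanks e pl))
  ... | yes pt@((s≤s z≤n , _) , _) | yes p1+t = settle (two-plateaus pt p1+t flanks)

  few-repeated⇒flanked : 1 ≤ n → r < 4 → ∃ λ i → AllPlateausFlank v (toℕ i)
  few-repeated⇒flanked 1≤n r<4 with FP.any? (repeated? v)
  ... | no none = fromℕ< 1≤n , λ e pl → contradiction (plateau⇒repeated v↑ pl) none
  ... | yes (j , rep) with to (repeated⇔plateau v↑ j) rep
  ...   | suc z , _ , px@((s≤s z≤n , 1+z<n) , _) with plateau? v (suc (suc z))
  ...     | yes p2+z = flanked-at 1+z<n λ y py →
                         flanking-between (≤-pred (plateaus-close r<4 py p2+z)) (plateaus-close r<4 px py)
  ...     | no ¬p2+z = flanked-at (<-trans (n<1+n z) 1+z<n) λ y py →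
                         flanking-between (≤-pred (plateaus-close r<4 py px)) (m<1+n⇒m≤n
                           (≤∧≢⇒< (plateaus-close r<4 px py) (λ y≡2+z → ¬p2+z (subst (Plateau v) y≡2+z py))))

  count-flanked : 1 ≤ n → count C? ≡ flankedPositions n r
  count-flanked 1≤n with FP.any? C?
  ... | yes (i , c) = flanked⇒count (to (C⇔ i) c)
  ... | no none = trans (count-none C? (λ i c → none (i , c))) (sym (flankedPositions-≥4 (≮⇒≥ λ r<4 →
                    let (i , flanks) = few-repeated⇒flanked 1≤n r<4 in none (i , from (C⇔ i) flanks))))

module _ {n} (π : Fin n → Permutation′ n) (3≤n : 3 ≤ n) where

  window-family-symmetric : (∀ i j → IsDes (π i) j ⇔ Window n (toℕ i) j) → IsSymmetric π
  window-family-symmetric des v v' v↑ v'↑ σ τ v'≡σvτ = begin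
    coeffQ π v                          ≡⟨ coeffQ-injective π injective v ⟩
    count (λ i → compatible? (π i) v)   ≡⟨ count-cong _ _ (λ i → compatible-window⇔unrepeated v↑ (π i) i (des i)) ⟩
    count (¬? ∘ repeated? v)            ≡⟨ count-unrepeated-relabel (Injection.injective (↔⇒↣ σ)) τ v'≡σvτ ⟨
    count (¬? ∘ repeated? v')           ≡⟨ count-cong _ _ (λ i → compatible-window⇔unrepeated v'↑ (π i) i (des i)) ⟨
    count (λ i → compatible? (π i) v')  ≡⟨ coeffQ-injective π injective v' ⟨
    coeffQ π v'                         ∎
    where
    open ≡-Reasoning
    injective : ∀ a b → π a ≈ π b → a ≡ b
    injective = descents-injective π des λ a b same →
      FP.toℕ-injective (window-injective 3≤n (FP.toℕ<n a) (FP.toℕ<n b) same)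

  cowindow-family-symmetric : (∀ i j → IsDes (π i) j ⇔ CoWindow n (toℕ i) j) → IsSymmetric π
  cowindow-family-symmetric des v v' v↑ v'↑ σ τ v'≡σvτ = begin
    coeffQ π v                                 ≡⟨ coeffQ-injective π injective v ⟩
    count (λ i → compatible? (π i) v)          ≡⟨ flanked v↑ ⟩
    flankedPositions n (count (repeated? v))   ≡⟨ cong (flankedPositions n) same-r ⟨
    flankedPositions n (count (repeated? v'))  ≡⟨ flanked v'↑ ⟨
    count (λ i → compatible? (π i) v')         ≡⟨ coeffQ-injective π injective v' ⟨
    coeffQ π v'                                ∎
    where
    open ≡-Reasoning
    injective : ∀ a b → π a ≈ π b → a ≡ b
    injective = descents-injective π des λ a b same →
      FP.toℕ-injective (cowindow-injective 3≤n (FP.toℕ<n a) (FP.toℕ<n b) same)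
    flanked : ∀ {u} → WeaklyIncreasing u → count (λ i → compatible? (π i) u) ≡ flankedPositions n (count (repeated? u))
    flanked {u} u↑ = count-flanked u↑ (λ i → compatible? (π i) u)
                       (λ i → compatible-cowindow⇔flanked u↑ (π i) i (des i)) (≤-trans (s≤s z≤n) 3≤n)
    same-r : count (repeated? v') ≡ count (repeated? v)
    same-r = count-repeated-relabel (Injection.injective (↔⇒↣ σ)) τ v'≡σvτ

proposition4p15 : (n : ℕ) (π : Fin n → Permutation′ n) →
    ((∀ (i : Fin n) (j : ℕ) → IsDes (π i) j ⇔ ((j ≡ toℕ i ⊎ j ≡ suc (toℕ i)) × (1 ≤ j) × (j < n)))
     ⊎ (∀ (i : Fin n) (j : ℕ) → IsDes (π i) j ⇔ (((1 ≤ j) × (j < n)) × ¬ (j ≡ toℕ i ⊎ j ≡ suc (toℕ i))))) →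
    IsSymmetric π
proposition4p15 n π descents with 3 ≤? n | descents
... | no n≱3  | _        = symmetric-≤2 π (≤-pred (≰⇒> n≱3))
... | yes 3≤n | inj₁ des = window-family-symmetric π 3≤n des
... | yes 3≤n | inj₂ des = cowindow-family-symmetric π 3≤n des
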